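{- Let $T$ be a triangulation of a (rectangular) grid graph. Then $T$ is $3$-colorable if and only if $T$ does not contain an induced subgraph isomorphic to a graph in $S$, where $S$ is the set of the eight graphs obtained by rotating $T_1$ and $T_2$ (drawn in the plane as described below) by multiples of $90^\circ$.
   Context: A grid graph is the graph of an $m\times n$ rectangle of unit squares: vertices are the corners of the squares and edges are the sides of the squares. A triangulation of it is obtained by adding, in each unit square, exactly one of its two diagonals as an edge. $T_1$ and $T_2$ are triangulations of the $3\times3$ grid graph with vertices $1,\dots,9$ placed as rows $1,2,3$ / $4,5,6$ / $7,8,9$ (top to bottom, left to right), grid edges $\{1,2\},\{2,3\},\{4,5\},\{5,6\},\{7,8\},\{8,9\},\{1,4\},\{4,7\},\{2,5\},\{5,8\},\{3,6\},\{6,9\}$; $T_1$ additionally has diagonals $\{5,7\},\{2,4\},\{6,8\},\{2,6\}$ and $T_2$ additionally has diagonals $\{4,8\},\{1,5\},\{5,9\},\{3,5\}$. A graph is $3$-colorable if its vertices can be colored with at most $3$ colors so that adjacent vertices receive different colors. -}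

module Defs where

open import Data.Nat using (ℕ; zero; suc; _+_; _*_)
open import Data.Fin using (Fin; toℕ; inject₁; opposite)
open import Data.Bool using (Bool; true; false)
open import Data.Product using (Σ; _×_; _,_)
open import Data.Sum using (_⊎_)
open import Data.List using (List; []; _∷_; _++_)
open import Data.List.Membership.Propositional using (_∈_)
open import Relation.Binary.PropositionalEquality using (_≡_; _≢_)
open import Function.Bundles using (_⇔_)
open import Function.Definitions using (Injective)

-- Grid graph of an m × n rectangle of unit squares.
-- Vertices: (row , column) with row ∈ {0..m}, column ∈ {0..n}.

Vertex : ℕ → ℕ → Set
Vertex m n = Fin (suc m) × Fin (suc n)

-- A triangulation chooses one diagonal in each unit square (i , j)
-- (i ∈ {0..m-1}, j ∈ {0..n-1}):
--   true  : diagonal (i , j) — (i+1 , j+1)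
--   false : diagonal (i , j+1) — (i+1 , j)
Triangulation : ℕ → ℕ → Set
Triangulation m n = Fin m → Fin n → Bool

data Edge {m n : ℕ} (t : Triangulation m n) : Vertex m n → Vertex m n → Set where
  horiz : ∀ {r c c'} → toℕ c' ≡ suc (toℕ c) → Edge t (r , c) (r , c')
  vert  : ∀ {r r' c} → toℕ r' ≡ suc (toℕ r) → Edge t (r , c) (r' , c)
  diag  : ∀ (i : Fin m) (j : Fin n) → t i j ≡ true →
          Edge t (inject₁ i , inject₁ j) (Fin.suc i , Fin.suc j)
  anti  : ∀ (i : Fin m) (j : Fin n) → t i j ≡ false →
          Edge t (inject₁ i , Fin.suc j) (Fin.suc i , inject₁ j)

Adj : {m n : ℕ} → Triangulation m n → Vertex m n → Vertex m n → Set
Adj t u v = Edge t u v ⊎ Edge t v u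

ThreeColorable : {m n : ℕ} → Triangulation m n → Set
ThreeColorable {m} {n} t =
  Σ (Vertex m n → Fin 3) λ col → ∀ (u v : Vertex m n) → Adj t u v → col u ≢ col v

-- The 3 × 3 grid (pattern) with vertices labelled 1..9 row by row:
--   1 2 3 / 4 5 6 / 7 8 9.

PVertex : Set
PVertex = Fin 3 × Fin 3

label : PVertex → ℕ
label (r , c) = suc (3 * toℕ r + toℕ c)

EdgeList : Set
EdgeList = List (ℕ × ℕ)

PAdj : EdgeList → PVertex → PVertex → Set
PAdj E u v = (label u , label v) ∈ E ⊎ (label v , label u) ∈ E

gridEdges : EdgeList
gridEdges = (1 , 2) ∷ (2 , 3) ∷ (4 , 5) ∷ (5 , 6) ∷ (7 , 8) ∷ (8 , 9) ∷
            (1 , 4) ∷ (4 , 7) ∷ (2 , 5) ∷ (5 , 8) ∷ (3 , 6) ∷ (6 , 9) ∷ []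

T₁ : EdgeList
T₁ = gridEdges ++ ((5 , 7) ∷ (2 , 4) ∷ (6 , 8) ∷ (2 , 6) ∷ [])

T₂ : EdgeList
T₂ = gridEdges ++ ((4 , 8) ∷ (1 , 5) ∷ (5 , 9) ∷ (3 , 5) ∷ [])

-- Rotation of the 3 × 3 grid by 90° (clockwise): (r , c) ↦ (c , 2 - r).
rot : PVertex → PVertex
rot (r , c) = (c , opposite r)

rotⁿ : ℕ → PVertex → PVertex
rotⁿ zero    p = p
rotⁿ (suc k) p = rot (rotⁿ k p)

Rotated : ℕ → EdgeList → PVertex → PVertex → Set
Rotated k E u v = PAdj E (rotⁿ k u) (rotⁿ k v)

data InS : (PVertex → PVertex → Set) → Set₁ where
  rotT₁ : (k : Fin 4) → InS (Rotated (toℕ k) T₁)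
  rotT₂ : (k : Fin 4) → InS (Rotated (toℕ k) T₂)

ContainsInduced : {m n : ℕ} → (PVertex → PVertex → Set) → Triangulation m n → Set
ContainsInduced {m} {n} H t =
  Σ (PVertex → Vertex m n) λ f →
    Injective _≡_ _≡_ f × (∀ (u v : PVertex) → H u v ⇔ Adj t (f u) (f v))

module Submission where

-- (⇒) T₁ contains the odd wheel W₅ and T₂ the odd wheel W₇ (both centred at
-- vertex 5), and odd wheels are not 3-colourable.  Rotations do not affect
-- colourability, and a colouring of T restricts to any induced subgraph.
--
-- (⇐) Describe T on ℕ-coordinates by its diagonal pattern g.  Call the 2 × 2
-- block of squares at (R , C) balanced when the squares (R , C), (R+1 , C)
-- have equal diagonals exactly when (R , C+1), (R+1 , C+1) do.  An unbalanced
-- block spans a 3 × 3 window of T that is, by a finite check, one of the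
-- eight forbidden graphs.  So if no forbidden graph occurs, every block is
-- balanced, which forces g R C = u R xor v C.  For such a pattern the
-- colouring (R , C) ↦ ρ R ⊕ γ C in ℤ/3, where ρ and γ advance by ±1 according
-- to u and v, is proper: along every edge the colour changes by ±1 or ±2.

open import Defs
open import Data.Nat using (ℕ; zero; suc; _+_; _*_; _≤_; _<_; s≤s; _<?_)
open import Data.Nat.Properties
  using (_≟_; +-cancelʳ-≡; +-monoˡ-≤; ≤-trans; ≤-pred; <⇒≤; *-suc; suc-injective)
open import Data.Fin as F using (Fin; toℕ; inject₁; fromℕ<; #_)
open import Data.Fin.Properties
  using (toℕ-injective; toℕ-inject₁; toℕ-fromℕ<; fromℕ<-toℕ; toℕ<n; opposite-involutive;
         punchOut-injective)
  renaming (all? to allFin?)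
open import Data.Bool using (Bool; true; false; not; _xor_)
open import Data.Bool.Properties using (xor-assoc; xor-comm; xor-same; not-involutive)
  renaming (_≟_ to _≟ᵇ_)
open import Data.Product using (Σ; _×_; _,_; proj₁; proj₂)
open import Data.Product.Properties using (≡-dec)
open import Data.Sum using (_⊎_; inj₁; inj₂)
open import Data.Sum.Function.Propositional using (_⊎-⇔_)
open import Data.List using (List; []; _∷_)
open import Data.List.Relation.Unary.All using (All; _∷_) renaming (all? to allList?)
open import Data.List.Relation.Unary.Linked using (Linked; _∷_; linked?)
open import Data.Empty using (⊥-elim)
open import Function using (_∘_)
open import Function.Bundles using (_⇔_; mk⇔; Equivalence)
import Function.Properties.Equivalence as ⇔
open import Relation.Nullary using (¬_; Dec; yes; no; does; contradiction)
open import Relation.Nullary.Decidable using (True; toWitness; map′; _×-dec_; _⊎-dec_; decidable-stable)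
open import Relation.Binary.PropositionalEquality
  using (_≡_; _≢_; refl; sym; trans; cong; cong₂; subst; subst₂; module ≡-Reasoning)
open import Data.List.Membership.DecPropositional (≡-dec _≟_ _≟_) using (_∈?_)

pattern 0F = F.zero
pattern 1F = F.suc F.zero
pattern 2F = F.suc (F.suc F.zero)

Proper : {A : Set} → (A → A → Set) → (A → Fin 3) → Set
Proper H col = ∀ u v → H u v → col u ≢ col v

ContainsForbidden : {m n : ℕ} → Triangulation m n → Set₁
ContainsForbidden t = Σ (PVertex → PVertex → Set) λ H → InS H × ContainsInduced H t

-- Odd wheels are not 3-colourable

-- If c, a, b are pairwise distinct colours, then a is the only colour
-- different from both c and b: removing c (punchOut) leaves just two colours.
third-colour : ∀ {c a b e : Fin 3} → c ≢ a → c ≢ b → a ≢ b → c ≢ e → b ≢ e → a ≡ e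
third-colour c≢a c≢b a≢b c≢e b≢e =
  punchOut-injective c≢a c≢e
    (two-valued (a≢b ∘ punchOut-injective c≢a c≢b) (b≢e ∘ sym ∘ punchOut-injective c≢e c≢b))
  where
  two-valued : ∀ {x y z : Fin 2} → x ≢ y → z ≢ y → x ≡ z
  two-valued {0F} {0F}         x≢y _   = contradiction refl x≢y
  two-valued {0F} {1F} {0F}    _   _   = refl
  two-valued {0F} {1F} {1F}    _   z≢y = contradiction refl z≢y
  two-valued {1F} {0F} {0F}    _   z≢y = contradiction refl z≢y
  two-valued {1F} {0F} {1F}    _   _   = refl
  two-valued {1F} {1F}         x≢y _   = contradiction refl x≢y

data Even {A : Set} : List A → Set where
  even-[]  : Even []
  even-∷∷ : ∀ {x y xs} → Even xs → Even (x ∷ y ∷ xs)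

lastOf : {A : Set} → A → List A → A
lastOf x []       = x
lastOf _ (y ∷ ys) = lastOf y ys

-- An odd wheel: a hub adjacent to every vertex of the closed rim walk
-- x ∷ xs → x, which has odd length 1 + length xs.
record OddWheel {A : Set} (H : A → A → Set) : Set where
  field
    hub     : A
    start   : A
    rest    : List A
    even    : Even rest
    spokes  : All (H hub) (start ∷ rest)
    rim     : Linked H (start ∷ rest)
    closing : H (lastOf start rest) start

-- Around a hub, a proper 3-colouring alternates between the two remaining
-- colours, so a rim walk of even length ends on the colour it started with.
alternation : ∀ {A : Set} {H : A → A → Set} {col : A → Fin 3} → Proper H col →
  ∀ {h x} xs → Even xs → All (H h) (x ∷ xs) → Linked H (x ∷ xs) → col x ≡ col (lastOf x xs)
alternation pr []           even-[]       _                    _                = refl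
alternation pr (y ∷ z ∷ zs) (even-∷∷ ev) (hx ∷ hy ∷ hzs@(hz ∷ _)) (xy ∷ yz ∷ rim) =
  trans (third-colour (pr _ _ hx) (pr _ _ hy) (pr _ _ xy) (pr _ _ hz) (pr _ _ yz))
        (alternation pr zs ev hzs rim)

-- The rim closes up with an edge between two vertices of equal colour.
oddWheel-uncolourable : ∀ {A : Set} {H : A → A → Set} → OddWheel H → ∀ col → ¬ Proper H col
oddWheel-uncolourable w col pr =
  pr _ _ closing (sym (alternation pr rest even spokes rim))
  where open OddWheel w

-- The forbidden graphs are not 3-colourable

pAdj? : (E : EdgeList) → ∀ u v → Dec (PAdj E u v)
pAdj? E u v = ((label u , label v) ∈? E) ⊎-dec ((label v , label u) ∈? E)

checkedWheel : (E : EdgeList) (h x : PVertex) (xs : List PVertex) → Even xs →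
  {True (allList? (pAdj? E h) (x ∷ xs))} → {True (linked? (pAdj? E) (x ∷ xs))} →
  {True (pAdj? E (lastOf x xs) x)} → OddWheel (PAdj E)
checkedWheel E h x xs ev {s} {r} {c} = record
  { hub = h ; start = x ; rest = xs ; even = ev
  ; spokes = toWitness s ; rim = toWitness r ; closing = toWitness c }

-- Vertex 5 of T₁ is the hub of the wheel with rim 2 4 7 8 6.
wheelT₁ : OddWheel (PAdj T₁)
wheelT₁ = checkedWheel T₁ (1F , 1F) (0F , 1F)
  ((1F , 0F) ∷ (2F , 0F) ∷ (2F , 1F) ∷ (1F , 2F) ∷ []) (even-∷∷ (even-∷∷ even-[]))

-- Vertex 5 of T₂ is the hub of the wheel with rim 1 2 3 6 9 8 4.
wheelT₂ : OddWheel (PAdj T₂)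
wheelT₂ = checkedWheel T₂ (1F , 1F) (0F , 0F)
  ((0F , 1F) ∷ (0F , 2F) ∷ (1F , 2F) ∷ (2F , 2F) ∷ (2F , 1F) ∷ (1F , 0F) ∷ [])
  (even-∷∷ (even-∷∷ (even-∷∷ even-[])))

rotⁿ-+ : ∀ j k p → rotⁿ (j + k) p ≡ rotⁿ j (rotⁿ k p)
rotⁿ-+ zero    k p = refl
rotⁿ-+ (suc j) k p = cong rot (rotⁿ-+ j k p)

rotⁿ-period : ∀ k p → rotⁿ (4 * k) p ≡ p
rotⁿ-period zero    p = refl
rotⁿ-period (suc k) p = begin
  rotⁿ (4 * suc k) p        ≡⟨ cong (λ j → rotⁿ j p) (*-suc 4 k) ⟩
  rotⁿ 4 (rotⁿ (4 * k) p)   ≡⟨ full-turn (rotⁿ (4 * k) p) ⟩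
  rotⁿ (4 * k) p            ≡⟨ rotⁿ-period k p ⟩
  p                         ∎
  where
  open ≡-Reasoning
  full-turn : ∀ q → rotⁿ 4 q ≡ q
  full-turn (r , c) = cong₂ _,_ (opposite-involutive r) (opposite-involutive c)

rotⁿ-inverse : ∀ k p → rotⁿ k (rotⁿ (3 * k) p) ≡ p
rotⁿ-inverse k p = trans (sym (rotⁿ-+ k (3 * k) p)) (rotⁿ-period k p)

pullback : ∀ {A B : Set} {H : B → B → Set} (φ : A → B) (ψ : B → A) → (∀ b → φ (ψ b) ≡ b) →
  ∀ {col} → Proper (λ u v → H (φ u) (φ v)) col → Proper H (col ∘ ψ)
pullback {H = H} φ ψ φψ pr u v huv = pr (ψ u) (ψ v) (subst₂ H (sym (φψ u)) (sym (φψ v)) huv)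

-- Each forbidden graph is a rotation of T₁ or T₂, which contain odd wheels.
forbidden-uncolourable : ∀ {H} → InS H → ∀ col → ¬ Proper H col
forbidden-uncolourable (rotT₁ k) col pr =
  oddWheel-uncolourable wheelT₁ _ (pullback (rotⁿ (toℕ k)) _ (rotⁿ-inverse (toℕ k)) pr)
forbidden-uncolourable (rotT₂ k) col pr =
  oddWheel-uncolourable wheelT₂ _ (pullback (rotⁿ (toℕ k)) _ (rotⁿ-inverse (toℕ k)) pr)

-- A colouring of T restricts to every induced subgraph of T.
colourable⇒noForbidden : ∀ {m n} {t : Triangulation m n} → ThreeColorable t → ¬ ContainsForbidden t
colourable⇒noForbidden (col , pr) (H , H∈S , f , _ , H≅) =
  forbidden-uncolourable H∈S (col ∘ f) λ u v h → pr (f u) (f v) (Equivalence.to (H≅ u v) h)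

-- Adjacency in ℕ-coordinates

Point : Set
Point = ℕ × ℕ

coords : ∀ {m n} → Vertex m n → Point
coords (r , c) = toℕ r , toℕ c

pcoords : PVertex → Point
pcoords = coords {2} {2}

_∈[_,_] : Point → ℕ → ℕ → Set
(R , C) ∈[ p , q ] = R ≤ p × C ≤ q

coords-∈ : ∀ {m n} (u : Vertex m n) → coords u ∈[ m , n ]
coords-∈ (r , c) = ≤-pred (toℕ<n r) , ≤-pred (toℕ<n c)

-- The edges from (R , C) in the quarter plane triangulated by the diagonal
-- pattern g: right, down, down-right if g R C, and from the upper-right
-- corner of square (R , C′) down-left to its lower-left corner if ¬ g R C′.
GridEdge : (ℕ → ℕ → Bool) → Point → Point → Set
GridEdge g (R , C) (R′ , C′) =
    (R′ ≡ R × C′ ≡ suc C)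
  ⊎ (R′ ≡ suc R × C′ ≡ C)
  ⊎ (R′ ≡ suc R × C′ ≡ suc C × g R C ≡ true)
  ⊎ (R′ ≡ suc R × C ≡ suc C′ × g R C′ ≡ false)

GridAdj : (ℕ → ℕ → Bool) → Point → Point → Set
GridAdj g x y = GridEdge g x y ⊎ GridEdge g y x

gridAdj? : ∀ g x y → Dec (GridAdj g x y)
gridAdj? g x y = gridEdge? x y ⊎-dec gridEdge? y x
  where
  gridEdge? : ∀ x y → Dec (GridEdge g x y)
  gridEdge? (R , C) (R′ , C′) =
    (R′ ≟ R ×-dec C′ ≟ suc C) ⊎-dec (R′ ≟ suc R ×-dec C′ ≟ C) ⊎-dec
    (R′ ≟ suc R ×-dec C′ ≟ suc C ×-dec g R C ≟ᵇ true) ⊎-dec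
    (R′ ≟ suc R ×-dec C ≟ suc C′ ×-dec g R C′ ≟ᵇ false)

GridAdj-resp : ∀ {g x x′ y y′} → x ≡ x′ → y ≡ y′ → GridAdj g x y ⇔ GridAdj g x′ y′
GridAdj-resp refl refl = ⇔.refl

diagonals : ∀ {m n} → Triangulation m n → ℕ → ℕ → Bool
diagonals {m} {n} t R C with R <? m | C <? n
... | yes R<m | yes C<n = t (fromℕ< R<m) (fromℕ< C<n)
... | _       | _       = false

diagonals-inject₁ : ∀ {m n} (t : Triangulation m n) i j →
  diagonals t (toℕ (inject₁ i)) (toℕ (inject₁ j)) ≡ t i j
diagonals-inject₁ {m} {n} t i j
  rewrite toℕ-inject₁ i | toℕ-inject₁ j with toℕ i <? m | toℕ j <? n
... | yes i<m | yes j<n = cong₂ t (fromℕ<-toℕ i i<m) (fromℕ<-toℕ j j<n)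
... | no i≮m  | _       = contradiction (toℕ<n i) i≮m
... | yes _   | no j≮n  = contradiction (toℕ<n j) j≮n

predecessor : ∀ {k} {r : Fin (suc k)} {i : Fin k} → toℕ (F.suc i) ≡ suc (toℕ r) → r ≡ inject₁ i
predecessor {i = i} p = toℕ-injective (trans (sym (suc-injective p)) (sym (toℕ-inject₁ i)))

edge⇒gridEdge : ∀ {m n} {t : Triangulation m n} {u v} → Edge t u v →
  GridEdge (diagonals t) (coords u) (coords v)
edge⇒gridEdge (horiz p) = inj₁ (refl , p)
edge⇒gridEdge (vert p)  = inj₂ (inj₁ (p , refl))
edge⇒gridEdge {t = t} (diag i j e) = inj₂ (inj₂ (inj₁
  (cong suc (sym (toℕ-inject₁ i)) , cong suc (sym (toℕ-inject₁ j)) ,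
   trans (diagonals-inject₁ t i j) e)))
edge⇒gridEdge {t = t} (anti i j e) = inj₂ (inj₂ (inj₂
  (cong suc (sym (toℕ-inject₁ i)) , cong suc (sym (toℕ-inject₁ j)) ,
   trans (diagonals-inject₁ t i j) e)))

gridEdge⇒edge : ∀ {m n} (t : Triangulation m n) u v →
  GridEdge (diagonals t) (coords u) (coords v) → Edge t u v
gridEdge⇒edge t (r , c) (r′ , c′) (inj₁ (p , q)) with toℕ-injective p
... | refl = horiz q
gridEdge⇒edge t (r , c) (r′ , c′) (inj₂ (inj₁ (p , q))) with toℕ-injective q
... | refl = vert p
gridEdge⇒edge t (r , c) (F.suc i , F.suc j) (inj₂ (inj₂ (inj₁ (p , q , e))))
  with predecessor {r = r} p | predecessor {r = c} q
... | refl | refl = diag i j (trans (sym (diagonals-inject₁ t i j)) e)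
gridEdge⇒edge t (r , F.suc j) (F.suc i , c′) (inj₂ (inj₂ (inj₂ (p , q , e))))
  with predecessor {r = r} p | predecessor {r = c′} q
... | refl | refl = anti i j (trans (sym (diagonals-inject₁ t i j)) e)
gridEdge⇒edge t (r , c) (0F , c′) (inj₂ (inj₂ (inj₁ (() , _))))
gridEdge⇒edge t (r , c) (F.suc i , 0F) (inj₂ (inj₂ (inj₁ (_ , () , _))))
gridEdge⇒edge t (r , c) (0F , c′) (inj₂ (inj₂ (inj₂ (() , _))))
gridEdge⇒edge t (r , 0F) (F.suc i , c′) (inj₂ (inj₂ (inj₂ (_ , () , _))))

Adj⇔GridAdj : ∀ {m n} (t : Triangulation m n) u v →
  Adj t u v ⇔ GridAdj (diagonals t) (coords u) (coords v)
Adj⇔GridAdj t u v =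
  mk⇔ edge⇒gridEdge (gridEdge⇒edge t u v) ⊎-⇔ mk⇔ edge⇒gridEdge (gridEdge⇒edge t v u)

-- Windows

shiftPattern : (ℕ → ℕ → Bool) → Point → ℕ → ℕ → Bool
shiftPattern g (R , C) x y = g (x + R) (y + C)

translate : Point → Point → Point
translate (R , C) (x , y) = x + R , y + C

translate-edge : ∀ g o x y → GridEdge g (translate o x) (translate o y) ⇔ GridEdge (shiftPattern g o) x y
translate-edge g (R , C) (a , b) (a′ , b′) = mk⇔ to from
  where
  cancelR : ∀ {x y} → x + R ≡ y + R → x ≡ y
  cancelR = +-cancelʳ-≡ R _ _
  cancelC : ∀ {x y} → x + C ≡ y + C → x ≡ y
  cancelC = +-cancelʳ-≡ C _ _
  to : GridEdge g (a + R , b + C) (a′ + R , b′ + C) → GridEdge (shiftPattern g (R , C)) (a , b) (a′ , b′)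
  to (inj₁ (p , q))                   = inj₁ (cancelR p , cancelC q)
  to (inj₂ (inj₁ (p , q)))            = inj₂ (inj₁ (cancelR p , cancelC q))
  to (inj₂ (inj₂ (inj₁ (p , q , e)))) = inj₂ (inj₂ (inj₁ (cancelR p , cancelC q , e)))
  to (inj₂ (inj₂ (inj₂ (p , q , e)))) = inj₂ (inj₂ (inj₂ (cancelR p , cancelC q , e)))
  from : GridEdge (shiftPattern g (R , C)) (a , b) (a′ , b′) → GridEdge g (a + R , b + C) (a′ + R , b′ + C)
  from (inj₁ (refl , refl))                   = inj₁ (refl , refl)
  from (inj₂ (inj₁ (refl , refl)))            = inj₂ (inj₁ (refl , refl))
  from (inj₂ (inj₂ (inj₁ (refl , refl , e)))) = inj₂ (inj₂ (inj₁ (refl , refl , e)))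
  from (inj₂ (inj₂ (inj₂ (refl , refl , e)))) = inj₂ (inj₂ (inj₂ (refl , refl , e)))

local-edge : ∀ {g g′ p q} → (∀ R C → R < p → C < q → g R C ≡ g′ R C) →
  ∀ {x y} → x ∈[ p , q ] → y ∈[ p , q ] → GridEdge g x y → GridEdge g′ x y
local-edge agree _ _ (inj₁ h)        = inj₁ h
local-edge agree _ _ (inj₂ (inj₁ h)) = inj₂ (inj₁ h)
local-edge agree _ (R′≤p , C′≤q) (inj₂ (inj₂ (inj₁ (refl , refl , e)))) =
  inj₂ (inj₂ (inj₁ (refl , refl , trans (sym (agree _ _ R′≤p C′≤q)) e)))
local-edge agree (_ , C≤q) (R′≤p , _) (inj₂ (inj₂ (inj₂ (refl , refl , e)))) =
  inj₂ (inj₂ (inj₂ (refl , refl , trans (sym (agree _ _ R′≤p C≤q)) e)))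

local-adj : ∀ {g g′ p q} → (∀ R C → R < p → C < q → g R C ≡ g′ R C) →
  ∀ {x y} → x ∈[ p , q ] → y ∈[ p , q ] → GridAdj g x y ⇔ GridAdj g′ x y
local-adj agree x∈ y∈ =
  mk⇔ (local-edge agree x∈ y∈) (local-edge (λ R C r c → sym (agree R C r c)) x∈ y∈) ⊎-⇔
  mk⇔ (local-edge agree y∈ x∈) (local-edge (λ R C r c → sym (agree R C r c)) y∈ x∈)

block : Bool → Bool → Bool → Bool → ℕ → ℕ → Bool
block a b c e 0 0 = a
block a b c e 0 1 = b
block a b c e 1 0 = c
block a b c e 1 1 = e
block a b c e _ _ = false

block-agrees : ∀ g R C x y → x < 2 → y < 2 →
  shiftPattern g (R , C) x y ≡ block (g R C) (g R (suc C)) (g (suc R) C) (g (suc R) (suc C)) x y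
block-agrees g R C 0 0 _ _ = refl
block-agrees g R C 0 1 _ _ = refl
block-agrees g R C 1 0 _ _ = refl
block-agrees g R C 1 1 _ _ = refl
block-agrees g R C (suc (suc _)) _ (s≤s (s≤s ())) _
block-agrees g R C 0 (suc (suc _)) _ (s≤s (s≤s ()))
block-agrees g R C 1 (suc (suc _)) _ (s≤s (s≤s ()))

offset : ∀ {k} R → 2 + R ≤ k → Fin 3 → Fin (suc k)
offset R h a = fromℕ< (s≤s (≤-trans (+-monoˡ-≤ R (≤-pred (toℕ<n a))) h))

window : ∀ {m n} R C → 2 + R ≤ m → 2 + C ≤ n → PVertex → Vertex m n
window R C hR hC (a , b) = offset R hR a , offset C hC b

coords-window : ∀ {m n} R C hR hC u → coords (window {m} {n} R C hR hC u) ≡ translate (R , C) (coords u)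
coords-window R C hR hC (a , b) = cong₂ _,_ (toℕ-fromℕ< _) (toℕ-fromℕ< _)

window-injective : ∀ {m n} R C hR hC {u v} → window {m} {n} R C hR hC u ≡ window R C hR hC v → u ≡ v
window-injective R C hR hC {u} {v} eq =
  cong₂ _,_ (toℕ-injective (+-cancelʳ-≡ R _ _ (cong proj₁ same)))
            (toℕ-injective (+-cancelʳ-≡ C _ _ (cong proj₂ same)))
  where
  same : translate (R , C) (coords u) ≡ translate (R , C) (coords v)
  same = trans (sym (coords-window R C hR hC u)) (trans (cong coords eq) (coords-window R C hR hC v))

-- Unbalanced blocks are forbidden graphs

sameEdges? : ∀ {H G : PVertex → PVertex → Set} →
  (H? : ∀ u v → Dec (H u v)) (G? : ∀ u v → Dec (G u v)) →
  Dec (∀ u v → does (H? u v) ≡ does (G? u v))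
sameEdges? H? G? = allPV? λ u → allPV? λ v → does (H? u v) ≟ᵇ does (G? u v)
  where
  allPV? : ∀ {P : PVertex → Set} → (∀ u → Dec (P u)) → Dec (∀ u → P u)
  allPV? P? = map′ (λ all (r , c) → all r c) (λ all r c → all (r , c))
    (allFin? λ r → allFin? λ c → P? (r , c))

agreement⇔ : ∀ {A B : Set} (a? : Dec A) (b? : Dec B) → does a? ≡ does b? → A ⇔ B
agreement⇔ (yes a) (yes b) _  = mk⇔ (λ _ → b) (λ _ → a)
agreement⇔ (no ¬a) (no ¬b) _  = mk⇔ (⊥-elim ∘ ¬a) (⊥-elim ∘ ¬b)
agreement⇔ (yes _) (no _)  ()
agreement⇔ (no _)  (yes _) ()

inS? : ∀ {H} → InS H → ∀ u v → Dec (H u v)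
inS? (rotT₁ k) u v = pAdj? T₁ (rotⁿ (toℕ k) u) (rotⁿ (toℕ k) v)
inS? (rotT₂ k) u v = pAdj? T₂ (rotⁿ (toℕ k) u) (rotⁿ (toℕ k) v)

blockAdj? : ∀ a b c e u v → Dec (GridAdj (block a b c e) (pcoords u) (pcoords v))
blockAdj? a b c e u v = gridAdj? (block a b c e) (pcoords u) (pcoords v)

BlockIsForbidden : Bool → Bool → Bool → Bool → Set₁
BlockIsForbidden a b c e = Σ (PVertex → PVertex → Set) λ H →
  InS H × (∀ u v → H u v ⇔ GridAdj (block a b c e) (pcoords u) (pcoords v))

matches : ∀ {a b c e H} (H∈S : InS H) → {True (sameEdges? (inS? H∈S) (blockAdj? a b c e))} →
  BlockIsForbidden a b c e
matches {a} {b} {c} {e} H∈S {same} =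
  _ , H∈S , λ u v → agreement⇔ (inS? H∈S u v) (blockAdj? a b c e u v) (toWitness same u v)

unbalanced⇒forbidden : ∀ a b c e → a xor c ≢ b xor e → BlockIsForbidden a b c e
unbalanced⇒forbidden true  true  true  false _ = matches (rotT₁ (# 3))
unbalanced⇒forbidden false true  true  true  _ = matches (rotT₁ (# 1))
unbalanced⇒forbidden false true  false false _ = matches (rotT₁ (# 0))
unbalanced⇒forbidden false false true  false _ = matches (rotT₁ (# 2))
unbalanced⇒forbidden true  false true  true  _ = matches (rotT₂ (# 0))
unbalanced⇒forbidden true  false false false _ = matches (rotT₂ (# 1))
unbalanced⇒forbidden true  true  false true  _ = matches (rotT₂ (# 2))
unbalanced⇒forbidden false false false true  _ = matches (rotT₂ (# 3))
unbalanced⇒forbidden true  true  true  true  u = contradiction refl u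
unbalanced⇒forbidden true  true  false false u = contradiction refl u
unbalanced⇒forbidden true  false true  false u = contradiction refl u
unbalanced⇒forbidden true  false false true  u = contradiction refl u
unbalanced⇒forbidden false true  true  false u = contradiction refl u
unbalanced⇒forbidden false true  false true  u = contradiction refl u
unbalanced⇒forbidden false false true  true  u = contradiction refl u
unbalanced⇒forbidden false false false false u = contradiction refl u

-- Whether the squares (R , C) and (R+1 , C) carry different diagonals.  The
-- block at (R , C) is balanced when rowFlip g R C ≡ rowFlip g R (suc C).
rowFlip : (ℕ → ℕ → Bool) → ℕ → ℕ → Bool
rowFlip g R C = g R C xor g (suc R) C

unbalanced⇒forbidden-copy : ∀ {m n} (t : Triangulation m n) R C (hR : 2 + R ≤ m) (hC : 2 + C ≤ n) →
  rowFlip (diagonals t) R C ≢ rowFlip (diagonals t) R (suc C) → ContainsForbidden t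
unbalanced⇒forbidden-copy t R C hR hC unbalanced =
  copy (unbalanced⇒forbidden (g R C) (g R (suc C)) (g (suc R) C) (g (suc R) (suc C)) unbalanced)
  where
  g : ℕ → ℕ → Bool
  g = diagonals t
  w : PVertex → Vertex _ _
  w = window R C hR hC
  window-adj : ∀ u v →
    Adj t (w u) (w v) ⇔ GridAdj (block (g R C) (g R (suc C)) (g (suc R) C) (g (suc R) (suc C))) (pcoords u) (pcoords v)
  window-adj u v =
    ⇔.trans (Adj⇔GridAdj t (w u) (w v)) (
    ⇔.trans (GridAdj-resp {g = g} (coords-window R C hR hC u) (coords-window R C hR hC v)) (
    ⇔.trans (translate-edge g (R , C) (pcoords u) (pcoords v) ⊎-⇔ translate-edge g (R , C) (pcoords v) (pcoords u))
            (local-adj (block-agrees g R C) (coords-∈ u) (coords-∈ v))))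
  copy : BlockIsForbidden (g R C) (g R (suc C)) (g (suc R) C) (g (suc R) (suc C)) → ContainsForbidden t
  copy (H , H∈S , H≅block) =
    H , H∈S , w , window-injective R C hR hC , λ u v → ⇔.trans (H≅block u v) (⇔.sym (window-adj u v))

-- Balanced patterns are a row pattern plus a column pattern

Balanced : (ℕ → ℕ → Bool) → ℕ → ℕ → Set
Balanced g m n = ∀ R C → 2 + R ≤ m → 2 + C ≤ n → rowFlip g R C ≡ rowFlip g R (suc C)

rowFlip-constant : ∀ {g m n} → Balanced g m n → ∀ R C → 2 + R ≤ m → C < n → rowFlip g R C ≡ rowFlip g R 0
rowFlip-constant     bal R zero    _  _  = refl
rowFlip-constant {g} bal R (suc C) hR hC = trans (sym (bal R C hR hC)) (rowFlip-constant {g} bal R C hR (<⇒≤ hC))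

rowPattern : (ℕ → ℕ → Bool) → ℕ → Bool
rowPattern g zero    = false
rowPattern g (suc R) = rowPattern g R xor rowFlip g R 0

xor-cancelˡ : ∀ x y → x xor (x xor y) ≡ y
xor-cancelˡ x y = trans (sym (xor-assoc x x y)) (cong (_xor y) (xor-same x))

xor-swapʳ : ∀ x y z → (x xor y) xor z ≡ (x xor z) xor y
xor-swapʳ x y z = begin
  (x xor y) xor z  ≡⟨ xor-assoc x y z ⟩
  x xor (y xor z)  ≡⟨ cong (x xor_) (xor-comm y z) ⟩
  x xor (z xor y)  ≡⟨ xor-assoc x z y ⟨
  (x xor z) xor y  ∎
  where open ≡-Reasoning

rank-one : ∀ {g m n} → Balanced g m n → ∀ R C → R < m → C < n → g R C ≡ rowPattern g R xor g 0 C
rank-one         bal zero    C _  _  = refl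
rank-one {g} bal (suc R) C hR hC = begin
  g (suc R) C                                    ≡⟨ xor-cancelˡ (g R C) (g (suc R) C) ⟨
  g R C xor rowFlip g R C                        ≡⟨ cong₂ _xor_ (rank-one {g} bal R C (<⇒≤ hR) hC)
                                                                (rowFlip-constant {g} bal R C hR hC) ⟩
  (rowPattern g R xor g 0 C) xor rowFlip g R 0   ≡⟨ xor-swapʳ (rowPattern g R) (g 0 C) (rowFlip g R 0) ⟩
  (rowPattern g R xor rowFlip g R 0) xor g 0 C   ∎
  where open ≡-Reasoning

-- Arithmetic in ℤ/3 on the colours

next : Fin 3 → Fin 3
next 0F = 1F
next 1F = 2F
next 2F = 0F

_⊕_ : Fin 3 → Fin 3 → Fin 3
x ⊕ 0F = x
x ⊕ 1F = next x
x ⊕ 2F = next (next x)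

next-cycle : ∀ x → next (next (next x)) ≡ x
next-cycle 0F = refl
next-cycle 1F = refl
next-cycle 2F = refl

⊕-next : ∀ x y → x ⊕ next y ≡ next (x ⊕ y)
⊕-next x 0F = refl
⊕-next x 1F = refl
⊕-next x 2F = sym (next-cycle x)

⊕-assoc : ∀ x y z → (x ⊕ y) ⊕ z ≡ x ⊕ (y ⊕ z)
⊕-assoc x y 0F = refl
⊕-assoc x y 1F = sym (⊕-next x y)
⊕-assoc x y 2F = sym (trans (⊕-next x (next y)) (cong next (⊕-next x y)))

⊕-comm : ∀ x y → x ⊕ y ≡ y ⊕ x
⊕-comm 0F 0F = refl
⊕-comm 0F 1F = refl
⊕-comm 0F 2F = refl
⊕-comm 1F 0F = refl
⊕-comm 1F 1F = refl
⊕-comm 1F 2F = refl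
⊕-comm 2F 0F = refl
⊕-comm 2F 1F = refl
⊕-comm 2F 2F = refl

⊕-swapʳ : ∀ x y z → (x ⊕ y) ⊕ z ≡ (x ⊕ z) ⊕ y
⊕-swapʳ x y z = begin
  (x ⊕ y) ⊕ z  ≡⟨ ⊕-assoc x y z ⟩
  x ⊕ (y ⊕ z)  ≡⟨ cong (x ⊕_) (⊕-comm y z) ⟩
  x ⊕ (z ⊕ y)  ≡⟨ ⊕-assoc x z y ⟨
  (x ⊕ z) ⊕ y  ∎
  where open ≡-Reasoning

step : Bool → Fin 3
step true  = 1F
step false = 2F

step-twice : ∀ b → step b ⊕ step b ≡ step (not b)
step-twice true  = refl
step-twice false = refl

step-moves : ∀ x b → x ≢ x ⊕ step b
step-moves 0F true  ()
step-moves 1F true  ()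
step-moves 2F true  ()
step-moves 0F false ()
step-moves 1F false ()
step-moves 2F false ()

-- The colour changes along the four kinds of edges: by ±1 along the
-- horizontal and vertical ones, by ±2 = ∓1 along the diagonal ones.
right-moves : ∀ x y b → x ⊕ y ≢ x ⊕ (y ⊕ step b)
right-moves x y b eq = step-moves (x ⊕ y) b (trans eq (sym (⊕-assoc x y (step b))))

down-moves : ∀ x y b → x ⊕ y ≢ (x ⊕ step b) ⊕ y
down-moves x y b eq = step-moves (x ⊕ y) b (trans eq (⊕-swapʳ x (step b) y))

diagonal-moves : ∀ x y b → x ⊕ y ≢ (x ⊕ step b) ⊕ (y ⊕ step b)
diagonal-moves x y b eq = step-moves (x ⊕ y) (not b) (trans eq twice)
  where
  open ≡-Reasoning
  twice : (x ⊕ step b) ⊕ (y ⊕ step b) ≡ (x ⊕ y) ⊕ step (not b)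
  twice = begin
    (x ⊕ step b) ⊕ (y ⊕ step b)  ≡⟨ ⊕-assoc (x ⊕ step b) y (step b) ⟨
    ((x ⊕ step b) ⊕ y) ⊕ step b  ≡⟨ cong (_⊕ step b) (⊕-swapʳ x (step b) y) ⟩
    ((x ⊕ y) ⊕ step b) ⊕ step b  ≡⟨ ⊕-assoc (x ⊕ y) (step b) (step b) ⟩
    (x ⊕ y) ⊕ (step b ⊕ step b)  ≡⟨ cong ((x ⊕ y) ⊕_) (step-twice b) ⟩
    (x ⊕ y) ⊕ step (not b)       ∎

antidiagonal-moves : ∀ x y b → x ⊕ (y ⊕ step b) ≢ (x ⊕ step (not b)) ⊕ y
antidiagonal-moves x y b eq = step-moves ((x ⊕ step (not b)) ⊕ y) (not b) (trans (sym eq) expand)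
  where
  open ≡-Reasoning
  expand : x ⊕ (y ⊕ step b) ≡ ((x ⊕ step (not b)) ⊕ y) ⊕ step (not b)
  expand = begin
    x ⊕ (y ⊕ step b)                          ≡⟨ ⊕-assoc x y (step b) ⟨
    (x ⊕ y) ⊕ step b                          ≡⟨ cong (λ b′ → (x ⊕ y) ⊕ step b′) (not-involutive b) ⟨
    (x ⊕ y) ⊕ step (not (not b))              ≡⟨ cong ((x ⊕ y) ⊕_) (step-twice (not b)) ⟨
    (x ⊕ y) ⊕ (step (not b) ⊕ step (not b))   ≡⟨ ⊕-assoc (x ⊕ y) (step (not b)) (step (not b)) ⟨
    ((x ⊕ y) ⊕ step (not b)) ⊕ step (not b)   ≡⟨ cong (_⊕ step (not b)) (⊕-swapʳ x y (step (not b))) ⟩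
    ((x ⊕ step (not b)) ⊕ y) ⊕ step (not b)   ∎

-- Colouring a rank-one pattern

xor≡true : ∀ x y → x xor y ≡ true → not x ≡ y
xor≡true true  false _ = refl
xor≡true false true  _ = refl
xor≡true true  true  ()
xor≡true false false ()

xor≡false : ∀ x y → x xor y ≡ false → x ≡ y
xor≡false true  true  _ = refl
xor≡false false false _ = refl
xor≡false true  false ()
xor≡false false true  ()

-- Diagonals then join points
-- whose colours differ by two equal steps, antidiagonals by opposite steps.
module RankOneColouring (u v : ℕ → Bool) where

  ρ : ℕ → Fin 3
  ρ zero    = 0F
  ρ (suc R) = ρ R ⊕ step (not (u R))

  γ : ℕ → Fin 3
  γ zero    = 0F
  γ (suc C) = γ C ⊕ step (v C)

  colour : Point → Fin 3
  colour (R , C) = ρ R ⊕ γ C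

  proper : ∀ {g m n} → (∀ R C → R < m → C < n → g R C ≡ u R xor v C) →
    ∀ {x y} → x ∈[ m , n ] → y ∈[ m , n ] → GridEdge g x y → colour x ≢ colour y
  proper pat {R , C} _ _ (inj₁ (refl , refl)) = right-moves (ρ R) (γ C) (v C)
  proper pat {R , C} _ _ (inj₂ (inj₁ (refl , refl))) = down-moves (ρ R) (γ C) (not (u R))
  proper pat {R , C} _ (R<m , C<n) (inj₂ (inj₂ (inj₁ (refl , refl , e)))) =
    subst (λ b → ρ R ⊕ γ C ≢ (ρ R ⊕ step (not (u R))) ⊕ (γ C ⊕ step b))
          (xor≡true (u R) (v C) (trans (sym (pat R C R<m C<n)) e))
          (diagonal-moves (ρ R) (γ C) (not (u R)))
  proper pat {R , _} {_ , C′} (_ , C′<n) (R<m , _) (inj₂ (inj₂ (inj₂ (refl , refl , e)))) =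
    subst (λ b → ρ R ⊕ (γ C′ ⊕ step (v C′)) ≢ (ρ R ⊕ step (not b)) ⊕ γ C′)
          (sym (xor≡false (u R) (v C′) (trans (sym (pat R C′ R<m C′<n)) e)))
          (antidiagonal-moves (ρ R) (γ C′) (v C′))

-- Without forbidden graphs every block is balanced, so the diagonal pattern
-- has rank one and the colouring of RankOneColouring applies.
noForbidden⇒colourable : ∀ {m n} (t : Triangulation m n) → ¬ ContainsForbidden t → ThreeColorable t
noForbidden⇒colourable {m} {n} t none = colour ∘ coords , proper-adj
  where
  g : ℕ → ℕ → Bool
  g = diagonals t
  balanced : Balanced g m n
  balanced R C hR hC = decidable-stable (rowFlip g R C ≟ᵇ rowFlip g R (suc C))
    (none ∘ unbalanced⇒forbidden-copy t R C hR hC)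
  open RankOneColouring (rowPattern g) (g 0)
  proper-edge : ∀ {x y} → Edge t x y → colour (coords x) ≢ colour (coords y)
  proper-edge {x} {y} e = proper (rank-one {g} balanced) (coords-∈ x) (coords-∈ y) (edge⇒gridEdge e)
  proper-adj : Proper (Adj t) (colour ∘ coords)
  proper-adj x y (inj₁ e) = proper-edge e
  proper-adj x y (inj₂ e) = proper-edge e ∘ sym

lemma5 : (m n : ℕ) (t : Triangulation m n) →
    ThreeColorable t ⇔
      (¬ Σ (PVertex → PVertex → Set) λ H → InS H × ContainsInduced H t)
lemma5 m n t = mk⇔ colourable⇒noForbidden (noForbidden⇒colourable t)
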